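{- For every integer $n\ge 3$, the number of Dumont permutations of the first kind of length $2n$ avoiding the pattern $123$ equals $4$, i.e. $|\mathfrak D^1_{2n}(123)|=4$.
   Context: A permutation $\sigma\in\mathfrak S_m$ contains a pattern $\tau\in\mathfrak S_k$ if $\sigma$ has a subsequence $(\sigma(i_1),\dots,\sigma(i_k))$, $i_1<\dots<i_k$, order-isomorphic to $\tau$; otherwise $\sigma$ avoids $\tau$. A Dumont permutation of the first kind of length $2n$ is a permutation $\pi\in\mathfrak S_{2n}$ such that for every $i$: if $\pi(i)$ is even then $i<2n$ and $\pi(i)>\pi(i+1)$; if $\pi(i)$ is odd then $i=2n$ or $\pi(i)<\pi(i+1)$. $\mathfrak D^1_{2n}(\tau)$ denotes the set of such permutations avoiding $\tau$. -}

module Defs where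

open import Data.Nat using (ℕ; zero; suc; _+_; _*_)
open import Data.Fin using (Fin; toℕ; suc; inject₁; _<_)
open import Data.Fin.Permutation using (Permutation′; _⟨$⟩ʳ_)
open import Data.List using (List; length)
open import Data.List.Relation.Unary.All using (All)
open import Data.List.Relation.Unary.Any using (Any)
open import Data.List.Relation.Unary.AllPairs using (AllPairs)
open import Data.Product using (_×_; ∃)
open import Relation.Binary.PropositionalEquality using (_≡_)
open import Relation.Nullary using (¬_)

-- Position i (0-based) corresponds to position toℕ i + 1, and the value
-- π(i) (a Fin m) corresponds to the integer toℕ (π ⟨$⟩ʳ i) + 1 in {1..m}.

data Even : ℕ → Set where
  even-zero : Even zero
  even-ss   : ∀ {n} → Even n → Even (suc (suc n))

Odd : ℕ → Set
Odd n = Even (suc n)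

val : ∀ {m} → Permutation′ m → Fin m → ℕ
val π i = suc (toℕ (π ⟨$⟩ʳ i))

-- With 0-based Fin (suc k): position j < k has successor inject₁/suc;
-- position "last" is the one with toℕ = k.
IsDumont1 : ∀ {m} → Permutation′ m → Set
IsDumont1 {zero}  π = Data.Unit.⊤
  where import Data.Unit
IsDumont1 {suc k} π =
  ∀ (j : Fin (suc k)) →
    (Even (val π j) → ∃ λ (j' : Fin k) → (inject₁ j' ≡ j) × (val π (suc j') Data.Nat.< val π j))
  × (Odd (val π j) → (toℕ j ≡ k) ⊎ (∃ λ (j' : Fin k) → (inject₁ j' ≡ j) × (val π j Data.Nat.< val π (suc j'))))
  where open import Data.Sum using (_⊎_)
        import Data.Nat

Contains123 : ∀ {m} → Permutation′ m → Set
Contains123 {m} π =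
  ∃ λ (i₁ : Fin m) → ∃ λ (i₂ : Fin m) → ∃ λ (i₃ : Fin m) →
    (i₁ < i₂) × (i₂ < i₃) ×
    (val π i₁ Data.Nat.< val π i₂) × (val π i₂ Data.Nat.< val π i₃)
  where import Data.Nat

Avoids123 : ∀ {m} → Permutation′ m → Set
Avoids123 π = ¬ Contains123 π

_≗ₚ_ : ∀ {m} → Permutation′ m → Permutation′ m → Set
_≗ₚ_ {m} π σ = ∀ (i : Fin m) → π ⟨$⟩ʳ i ≡ σ ⟨$⟩ʳ i

-- "the set {π ∈ S_m | P π} has exactly k elements": there is a list of k
-- pairwise distinct (extensionally) permutations, each satisfying P,
-- and every permutation satisfying P appears in the list.
HasCardinality : (m : ℕ) → (Permutation′ m → Set) → ℕ → Set
HasCardinality m P k =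
  ∃ λ (xs : List (Permutation′ m)) →
    (length xs ≡ k)
  × AllPairs (λ π σ → ¬ (π ≗ₚ σ)) xs
  × All P xs
  × (∀ (π : Permutation′ m) → P π → Any (λ σ → π ≗ₚ σ) xs)

D1-123 : ∀ {m} → Permutation′ m → Set
D1-123 π = IsDumont1 π × Avoids123 π

-- In a word of 𝔇¹_{2n}(123) with
-- K = 2n - 1 ≥ 7 the letters K, K + 1 come first. Indeed, if the odd letter K is not last it
-- is followed by a larger letter, i.e. by K + 1, and any letter in front of it would start a
-- 123 with K, K + 1. If K were last, every odd letter v is followed by a larger letter w, and w
-- is K + 1 or the final K since otherwise v w K is a 123; the three odd letters 1, 3, 5 cannot
-- all sit in front of just two positions. Deleting K, K + 1 gives a word of 𝔇¹_{2n-2}(123) and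
-- prepending them is the inverse, so everything reduces to 𝔇¹₆(123) = {436215, 562143,
-- 563421, 564213}, which is settled by exhaustive search.

module Submission where

open import Defs
open import Data.Nat
  using (ℕ; zero; suc; pred; _+_; _*_; _≤_; _<_; _>_; z≤n; s≤s; s≤s⁻¹; z<s; s<s; _≟_; _<?_; _≤?_)
open import Data.Nat.Properties
open import Data.Fin using (Fin; toℕ; fromℕ<; inject₁)
import Data.Fin.Properties as Fin
open import Data.Fin.Permutation using (Permutation′; _⟨$⟩ʳ_; _⟨$⟩ˡ_; permutation; inverseʳ)
open import Data.List using (List; []; _∷_; _∷ʳ_; applyUpTo; upTo; tabulate)
open import Data.List.Properties using (applyUpTo-∷ʳ; length-tabulate)
open import Data.List.Relation.Unary.All as All using (All)
import Data.List.Relation.Unary.All.Properties as All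
import Data.List.Relation.Unary.Any.Properties as Any
import Data.List.Relation.Unary.AllPairs.Properties as AllPairs
open import Data.List.Membership.Propositional using (_∈_; _∉_)
open import Data.List.Membership.DecPropositional _≟_ using (_∈?_)
open import Data.List.Membership.Propositional.Properties
  using (∈-upTo⁺; ∈-upTo⁻; ∈-applyUpTo⁺; ∈-applyUpTo⁻)
open import Data.Vec using (Vec; lookup) renaming (_∷_ to _∷ᵥ_; [] to []ᵥ)
open import Data.Product using (_×_; _,_; ∃; proj₁; proj₂)
open import Data.Sum as Sum using (_⊎_; inj₁; inj₂)
open import Data.Empty using (⊥; ⊥-elim)
open import Function using (_∘_; Injection)
open import Function.Properties.Inverse using (↔⇒↣)
open import Level using (0ℓ)
open import Relation.Nullary using (¬_; Dec; yes; no; contradiction)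
open import Relation.Nullary.Decidable using (map′; _×-dec_; _⊎-dec_; _→-dec_; ¬?; from-yes)
open import Relation.Unary using (Pred; Decidable)
open import Relation.Binary.PropositionalEquality
open ≡-Reasoning

even? : Decidable Even
even? zero          = yes even-zero
even? (suc zero)    = no λ ()
even? (suc (suc n)) = map′ even-ss (λ { (even-ss e) → e }) (even? n)

even⇒¬odd : ∀ {n} → Even n → ¬ Odd n
even⇒¬odd (even-ss e) (even-ss o) = even⇒¬odd e o

even-*2 : ∀ m → Even (m * 2)
even-*2 zero    = even-zero
even-*2 (suc m) = even-ss (even-*2 m)

-- A word of length N is a function ℕ → ℕ read at the positions 0, …, N - 1 only; its letters
-- are 1-based like val.
Word : Set
Word = ℕ → ℕ

infix 4 _≗⟨_⟩_
_≗⟨_⟩_ : Word → ℕ → Word → Set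
f ≗⟨ N ⟩ g = ∀ {i} → i < N → f i ≡ g i

≗-trans : ∀ {N f g h} → f ≗⟨ N ⟩ g → g ≗⟨ N ⟩ h → f ≗⟨ N ⟩ h
≗-trans e e′ i<N = trans (e i<N) (e′ i<N)

record IsPermWord (N : ℕ) (f : Word) : Set where
  field
    bounded    : ∀ {i} → i < N → 0 < f i × f i ≤ N
    injective  : ∀ {i j} → i < N → j < N → f i ≡ f j → i ≡ j
    surjective : ∀ {v} → 0 < v → v ≤ N → ∃ λ i → i < N × f i ≡ v

Descent Ascent : ℕ → Word → ℕ → Set
Descent N f i = suc i < N × f (suc i) < f i
Ascent  N f i = suc i < N × f i < f (suc i)

DumontAt : ℕ → Word → ℕ → Set
DumontAt N f i = (Even (f i) → Descent N f i) × (Odd (f i) → suc i ≡ N ⊎ Ascent N f i)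

IsDumontWord : ℕ → Word → Set
IsDumontWord N f = ∀ {i} → i < N → DumontAt N f i

Avoids123Word : ℕ → Word → Set
Avoids123Word N f = ∀ {i j k} → i < j → j < k → k < N → f i < f j → f j < f k → ⊥

record IsD¹123Word (N : ℕ) (f : Word) : Set where
  field
    isPermWord : IsPermWord N f
    isDumont   : IsDumontWord N f
    avoids123  : Avoids123Word N f
  open IsPermWord isPermWord public

isDumontWord-resp : ∀ {N f g} → f ≗⟨ N ⟩ g → IsDumontWord N f → IsDumontWord N g
isDumontWord-resp {N} {f} {g} e d {i} i<N = descent , ascent
  where
  moved : ∀ {R : ℕ → ℕ → Set} → suc i < N → R (f i) (f (suc i)) → R (g i) (g (suc i))
  moved {R} si<N = subst₂ R (e i<N) (e si<N)
  descent : Even (g i) → Descent N g i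
  descent ev with proj₁ (d i<N) (subst Even (sym (e i<N)) ev)
  ... | si<N , lt = si<N , moved {_>_} si<N lt
  ascent : Odd (g i) → suc i ≡ N ⊎ Ascent N g i
  ascent od with proj₂ (d i<N) (subst Odd (sym (e i<N)) od)
  ... | inj₁ last        = inj₁ last
  ... | inj₂ (si<N , lt) = inj₂ (si<N , moved {_<_} si<N lt)

avoids123Word-resp : ∀ {N f g} → f ≗⟨ N ⟩ g → Avoids123Word N f → Avoids123Word N g
avoids123Word-resp {N} e av {i} {j} i<j j<k k<N a b =
  av i<j j<k k<N (subst₂ _<_ (sym (e i<N)) (sym (e j<N)) a) (subst₂ _<_ (sym (e j<N)) (sym (e k<N)) b)
  where
  j<N : j < N
  j<N = <-trans j<k k<N
  i<N : i < N
  i<N = <-trans i<j j<N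

-- Unlike allUpTo?, this computes its verdict without normalising the proofs, which keeps the
-- exhaustive search fast.
∀<? : {P : Pred ℕ 0ℓ} → Decidable P → ∀ n → Dec (∀ {i} → i < n → P i)
∀<? P? n = map′ (λ all → All.lookup all ∘ ∈-upTo⁺) (λ h → All.tabulate (h ∘ ∈-upTo⁻))
                (All.all? P? (upTo n))

≗⟨_⟩? : ∀ N f g → Dec (f ≗⟨ N ⟩ g)
≗⟨ N ⟩? f g = ∀<? (λ i → f i ≟ g i) N

isPermWord? : ∀ N f → Dec (IsPermWord N f)
isPermWord? N f = map′ fromChecks toChecks
  (∀<? (λ i → 0 <? f i ×-dec f i ≤? N) N
   ×-dec ∀<? (λ i → ∀<? (λ j → f i ≟ f j →-dec i ≟ j) N) N
   ×-dec ∀<? (λ v → anyUpTo? (λ i → f i ≟ suc v) N) N)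
  where
  Checks : Set
  Checks = (∀ {i} → i < N → 0 < f i × f i ≤ N)
         × (∀ {i} → i < N → ∀ {j} → j < N → f i ≡ f j → i ≡ j)
         × (∀ {v} → v < N → ∃ λ i → i < N × f i ≡ suc v)
  fromChecks : Checks → IsPermWord N f
  fromChecks (b , inj , surj) = record
    { bounded    = λ {i} → b {i}
    ; injective  = λ i<N j<N → inj i<N j<N
    ; surjective = λ { {suc v} _ v<N → surj v<N } }
  toChecks : IsPermWord N f → Checks
  toChecks p = (λ {i} → bounded {i}) , (λ i<N j<N → injective i<N j<N) , surjective (s≤s z≤n)
    where open IsPermWord p

isDumontWord? : ∀ N f → Dec (IsDumontWord N f)
isDumontWord? N f = ∀<? (λ i → (even? (f i) →-dec (suc i <? N ×-dec f (suc i) <? f i))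
                          ×-dec (even? (suc (f i)) →-dec (suc i ≟ N ⊎-dec (suc i <? N ×-dec f i <? f (suc i))))) N

avoids123Word? : ∀ N f → Dec (Avoids123Word N f)
avoids123Word? N f = map′ (λ h i<j j<k k<N a b → h k<N j<k i<j (a , b))
                          (λ h {k} k<N {j} j<k {i} i<j (a , b) → h i<j j<k k<N a b)
  (∀<? (λ k → ∀<? (λ j → ∀<? (λ i → ¬? (f i <? f j ×-dec f j <? f k)) j) k) N)

isD¹123Word? : ∀ N f → Dec (IsD¹123Word N f)
isD¹123Word? N f = map′
  (λ (p , d , a) → record { isPermWord = p ; isDumont = λ {i} → d {i} ; avoids123 = λ {i j k} → a {i} {j} {k} })
  (λ w → let open IsD¹123Word w in isPermWord , (λ {i} → isDumont {i}) , λ {i j k} → avoids123 {i} {j} {k})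
  (isPermWord? N f ×-dec isDumontWord? N f ×-dec avoids123Word? N f)

-- 𝔇¹₆(123) by exhaustive search

listWord : List ℕ → Word
listWord []       _       = 0
listWord (x ∷ xs) zero    = x
listWord (x ∷ xs) (suc i) = listWord xs i

listWord-applyUpTo : ∀ f n → listWord (applyUpTo f n) ≗⟨ n ⟩ f
listWord-applyUpTo f (suc n) {zero}  _          = refl
listWord-applyUpTo f (suc n) {suc i} (s≤s i<n) = listWord-applyUpTo (f ∘ suc) n i<n

Arrangements : ℕ → ℕ → Pred (List ℕ) 0ℓ → Pred (List ℕ) 0ℓ
Arrangements N zero    P xs = P xs
Arrangements N (suc k) P xs = All (λ x → x ∉ xs → Arrangements N k P (xs ∷ʳ x)) (applyUpTo suc N)

arrangements? : ∀ N k {P} → Decidable P → Decidable (Arrangements N k P)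
arrangements? N zero    P? xs = P? xs
arrangements? N (suc k) P? xs =
  All.all? (λ x → ¬? (x ∈? xs) →-dec arrangements? N k P? (xs ∷ʳ x)) (applyUpTo suc N)

arrangements-applyUpTo : ∀ {N f P} → IsPermWord N f → ∀ {j} k → k + j ≤ N →
                         Arrangements N k P (applyUpTo f j) → P (applyUpTo f (k + j))
arrangements-applyUpTo p zero _ a = a
arrangements-applyUpTo {N} {f} {P} p {j} (suc k) k+j<N a =
  subst P (cong (applyUpTo f) (+-suc k j))
    (arrangements-applyUpTo p k (subst (_≤ N) (sym (+-suc k j)) k+j<N)
      (subst (Arrangements N k P) (applyUpTo-∷ʳ f j) (All.lookup a letter fresh)))
  where
  open IsPermWord p
  j<N : j < N
  j<N = ≤-trans (s≤s (m≤n+m j k)) k+j<N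
  letter : f j ∈ applyUpTo suc N
  letter with f j | bounded j<N
  ... | suc v | _ , v<N = ∈-applyUpTo⁺ suc v<N
  fresh : f j ∉ applyUpTo f j
  fresh fj∈ with ∈-applyUpTo⁻ f fj∈
  ... | i , i<j , fj≡fi = <-irrefl (injective (<-trans i<j j<N) j<N (sym fj≡fi)) i<j

blocks : Vec (List ℕ) 4
blocks = (4 ∷ 3 ∷ 6 ∷ 2 ∷ 1 ∷ 5 ∷ [])
      ∷ᵥ (5 ∷ 6 ∷ 2 ∷ 1 ∷ 4 ∷ 3 ∷ [])
      ∷ᵥ (5 ∷ 6 ∷ 3 ∷ 4 ∷ 2 ∷ 1 ∷ [])
      ∷ᵥ (5 ∷ 6 ∷ 4 ∷ 2 ∷ 1 ∷ 3 ∷ [])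
      ∷ᵥ []ᵥ

block : Fin 4 → Word
block β = listWord (lookup blocks β)

block-isD¹123Word : ∀ β → IsD¹123Word 6 (block β)
block-isD¹123Word = from-yes (Fin.all? λ β → isD¹123Word? 6 (block β))

block-injective : ∀ {β β′} → block β ≗⟨ 6 ⟩ block β′ → β ≡ β′
block-injective {β} {β′} =
  from-yes (Fin.all? λ β → Fin.all? λ β′ → ≗⟨ 6 ⟩? (block β) (block β′) →-dec β Fin.≟ β′) β β′

D¹123⇒Block : Pred Word 0ℓ
D¹123⇒Block f = IsDumontWord 6 f → Avoids123Word 6 f → ∃ λ β → f ≗⟨ 6 ⟩ block β

arrangements₆-D¹123⇒Block : Arrangements 6 6 (D¹123⇒Block ∘ listWord) []
arrangements₆-D¹123⇒Block = from-yes (arrangements? 6 6 (λ xs → let f = listWord xs in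
  isDumontWord? 6 f →-dec avoids123Word? 6 f →-dec Fin.any? λ β → ≗⟨ 6 ⟩? f (block β)) [])

classify₆ : ∀ {f} → IsD¹123Word 6 f → ∃ λ β → f ≗⟨ 6 ⟩ block β
classify₆ {f} w =
  let β , list≗block = arrangements-applyUpTo {P = D¹123⇒Block ∘ listWord} isPermWord {0} 6 ≤-refl
                         arrangements₆-D¹123⇒Block
                         (isDumontWord-resp f≗list isDumont) (avoids123Word-resp f≗list avoids123)
  in β , ≗-trans f≗list list≗block
  where
  open IsD¹123Word w
  f≗list : f ≗⟨ 6 ⟩ listWord (applyUpTo f 6)
  f≗list i<6 = sym (listWord-applyUpTo f 6 i<6)

-- Prepending and deleting the two largest letters

prependTop : ℕ → Word → Word
prependTop N g zero          = suc N
prependTop N g (suc zero)    = suc (suc N)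
prependTop N g (suc (suc i)) = g i

module _ {N g} (p : IsPermWord N g) where
  open IsPermWord p

  prependTop-isPermWord : IsPermWord (2 + N) (prependTop N g)
  prependTop-isPermWord = record { bounded = bounded′ ; injective = injective′ ; surjective = surjective′ }
    where
    below : ∀ {i} → i < N → g i < suc N
    below i<N = s≤s (proj₂ (bounded i<N))
    bounded′ : ∀ {i} → i < 2 + N → 0 < prependTop N g i × prependTop N g i ≤ 2 + N
    bounded′ {zero}        _                 = s≤s z≤n , n≤1+n _
    bounded′ {suc zero}    _                 = s≤s z≤n , ≤-refl
    bounded′ {suc (suc i)} (s≤s (s≤s i<N)) = proj₁ (bounded i<N) , m≤n⇒m≤1+n (<⇒≤ (below i<N))
    injective′ : ∀ {i j} → i < 2 + N → j < 2 + N → prependTop N g i ≡ prependTop N g j → i ≡ j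
    injective′ {zero}        {zero}        _ _ _ = refl
    injective′ {suc zero}    {suc zero}    _ _ _ = refl
    injective′ {zero}        {suc zero}    _ _ e = contradiction e (<⇒≢ ≤-refl)
    injective′ {suc zero}    {zero}        _ _ e = contradiction (sym e) (<⇒≢ ≤-refl)
    injective′ {zero}        {suc (suc j)} _ (s≤s (s≤s j<N)) e = contradiction (sym e) (<⇒≢ (below j<N))
    injective′ {suc (suc i)} {zero}        (s≤s (s≤s i<N)) _ e = contradiction e (<⇒≢ (below i<N))
    injective′ {suc zero}    {suc (suc j)} _ (s≤s (s≤s j<N)) e = contradiction (sym e) (<⇒≢ (m<n⇒m<1+n (below j<N)))
    injective′ {suc (suc i)} {suc zero}    (s≤s (s≤s i<N)) _ e = contradiction e (<⇒≢ (m<n⇒m<1+n (below i<N)))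
    injective′ {suc (suc i)} {suc (suc j)} (s≤s (s≤s i<N)) (s≤s (s≤s j<N)) e = cong (2 +_) (injective i<N j<N e)
    surjective′ : ∀ {v} → 0 < v → v ≤ 2 + N → ∃ λ i → i < 2 + N × prependTop N g i ≡ v
    surjective′ 0<v v≤ with m≤n⇒m<n∨m≡n v≤
    ... | inj₂ refl = 1 , s≤s (s≤s z≤n) , refl
    ... | inj₁ (s≤s v≤) with m≤n⇒m<n∨m≡n v≤
    ...   | inj₂ refl = 0 , s≤s z≤n , refl
    ...   | inj₁ (s≤s v≤N) = let i , i<N , gi≡v = surjective 0<v v≤N in 2 + i , s≤s (s≤s i<N) , gi≡v

prependTop-isD¹123Word : ∀ {N g} → Even N → 0 < N → IsD¹123Word N g → IsD¹123Word (2 + N) (prependTop N g)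
prependTop-isD¹123Word {N} {g} evenN 0<N w = record
  { isPermWord = p′ ; isDumont = dumont ; avoids123 = avoids }
  where
  open IsD¹123Word w
  p′ : IsPermWord (2 + N) (prependTop N g)
  p′ = prependTop-isPermWord isPermWord
  f : Word
  f = prependTop N g
  dumont : IsDumontWord (2 + N) f
  dumont {zero}        _ = (λ ev → contradiction ev (even⇒¬odd evenN)) ,
                           (λ _ → inj₂ (s≤s (s≤s z≤n) , ≤-refl))
  dumont {suc zero}    _ = (λ _ → s≤s (s≤s 0<N) , s≤s (m≤n⇒m≤1+n (proj₂ (bounded 0<N)))) ,
                           (λ { (even-ss od) → contradiction od (even⇒¬odd evenN) })
  dumont {suc (suc i)} (s≤s (s≤s i<N)) with isDumont i<N
  ... | descent , ascent =
        (λ ev → let si<N , lt = descent ev in s≤s (s≤s si<N) , lt) ,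
        (λ od → Sum.map (cong (2 +_)) (λ (si<N , lt) → s≤s (s≤s si<N) , lt) (ascent od))
  top : ∀ {i} → i < 2 + N → f i ≤ 2 + N
  top = proj₂ ∘ IsPermWord.bounded p′
  avoids : Avoids123Word (2 + N) f
  avoids {zero} {suc zero} _ _ k<N _ b = <⇒≱ b (top k<N)
  avoids {zero} {suc (suc j)} _ (s≤s (s≤s j<k)) (s≤s (s≤s k<N)) a _ =
    <⇒≱ a (m≤n⇒m≤1+n (proj₂ (bounded (<-trans j<k k<N))))
  avoids {suc zero} {j} _ j<k k<N a _ = <⇒≱ a (top (<-trans j<k k<N))
  avoids {suc (suc i)} {suc (suc j)} {suc (suc k)} (s≤s (s≤s i<j)) (s≤s (s≤s j<k)) (s≤s (s≤s k<N)) =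
    avoids123 i<j j<k k<N

≗-prependTop : ∀ {N f g} → f 0 ≡ suc N → f 1 ≡ 2 + N → f ∘ (2 +_) ≗⟨ N ⟩ g → f ≗⟨ 2 + N ⟩ prependTop N g
≗-prependTop f0 f1 e {zero}        _                 = f0
≗-prependTop f0 f1 e {suc zero}    _                 = f1
≗-prependTop f0 f1 e {suc (suc i)} (s≤s (s≤s i<N)) = e i<N

dropTop-isD¹123Word : ∀ {N f} → IsD¹123Word (2 + N) f → f 0 ≡ suc N → f 1 ≡ 2 + N →
                      IsD¹123Word N (f ∘ (2 +_))
dropTop-isD¹123Word {N} {f} w f0 f1 = record
  { isPermWord = record { bounded = bounded′ ; injective = injective′ ; surjective = surjective′ }
  ; isDumont   = dumont
  ; avoids123  = λ i<j j<k k<N → avoids123 (s≤s (s≤s i<j)) (s≤s (s≤s j<k)) (s≤s (s≤s k<N))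
  }
  where
  open IsD¹123Word w
  bounded′ : ∀ {i} → i < N → 0 < f (2 + i) × f (2 + i) ≤ N
  bounded′ {i} i<N with bounded (s≤s (s≤s i<N))
  ... | 0<fi , fi≤ = 0<fi , s≤s⁻¹ (≤∧≢⇒< (s≤s⁻¹ (≤∧≢⇒< fi≤ ≢top)) ≢suc)
    where
    ≢top : f (2 + i) ≢ 2 + N
    ≢top e = contradiction (injective (s≤s (s≤s i<N)) (s≤s (s≤s z≤n)) (trans e (sym f1))) λ ()
    ≢suc : f (2 + i) ≢ suc N
    ≢suc e = contradiction (injective (s≤s (s≤s i<N)) (s≤s z≤n) (trans e (sym f0))) λ ()
  injective′ : ∀ {i j} → i < N → j < N → f (2 + i) ≡ f (2 + j) → i ≡ j
  injective′ i<N j<N e = suc-injective (suc-injective (injective (s≤s (s≤s i<N)) (s≤s (s≤s j<N)) e))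
  surjective′ : ∀ {v} → 0 < v → v ≤ N → ∃ λ i → i < N × f (2 + i) ≡ v
  surjective′ 0<v v≤N with surjective 0<v (m≤n⇒m≤1+n (m≤n⇒m≤1+n v≤N))
  ... | zero          , _                 , fi≡v = contradiction (trans (sym f0) fi≡v) (<⇒≢ (s≤s v≤N) ∘ sym)
  ... | suc zero      , _                 , fi≡v = contradiction (trans (sym f1) fi≡v) (<⇒≢ (m<n⇒m<1+n (s≤s v≤N)) ∘ sym)
  ... | suc (suc i)   , s≤s (s≤s i<N)   , fi≡v = i , i<N , fi≡v
  dumont : IsDumontWord N (f ∘ (2 +_))
  dumont i<N with isDumont (s≤s (s≤s i<N))
  ... | descent , ascent =
        (λ ev → let si<N , lt = descent ev in s≤s⁻¹ (s≤s⁻¹ si<N) , lt) ,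
        (λ od → Sum.map (suc-injective ∘ suc-injective) (λ (si<N , lt) → s≤s⁻¹ (s≤s⁻¹ si<N) , lt)
                        (ascent od))

no-three-in-two : ∀ {a b} → 1 ≡ a ⊎ 1 ≡ b → 3 ≡ a ⊎ 3 ≡ b → ¬ (5 ≡ a ⊎ 5 ≡ b)
no-three-in-two (inj₁ refl) (inj₂ refl) (inj₁ ())
no-three-in-two (inj₁ refl) (inj₂ refl) (inj₂ ())
no-three-in-two (inj₂ refl) (inj₁ refl) (inj₁ ())
no-three-in-two (inj₂ refl) (inj₁ refl) (inj₂ ())

module _ {K f} (w : IsD¹123Word (suc K) f) where
  open IsD¹123Word w

  private
    below-top : ∀ {i} → i < suc K → f i ≢ suc K → f i ≢ K → f i < K
    below-top i<N ≢suc ≢K = ≤∧≢⇒< (s≤s⁻¹ (≤∧≢⇒< (proj₂ (bounded i<N)) ≢suc)) ≢K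

  odd-precedes-top-or-last : ∀ {p v} → f K ≡ K → p < suc K → f p ≡ suc K → Odd v → 0 < v → v < K →
                             v ≡ f (pred p) ⊎ v ≡ f (pred K)
  odd-precedes-top-or-last fK p<N fp odd 0<v v<K
    with surjective 0<v (m≤n⇒m≤1+n (<⇒≤ v<K))
  ... | r , r<N , refl with proj₂ (isDumont r<N) odd
  ...   | inj₁ last = contradiction (trans (sym fK) (cong f (sym (suc-injective last)))) (<⇒≢ v<K ∘ sym)
  ...   | inj₂ (sr<N , fr<fsr) with f (suc r) ≟ suc K | suc r ≟ K
  ...     | yes top | _        = inj₁ (cong (f ∘ pred) (injective sr<N p<N (trans top (sym fp))))
  ...     | no _    | yes refl = inj₂ refl
  ...     | no ¬top | no ¬last =
            ⊥-elim (avoids123 ≤-refl (≤∧≢⇒< (s≤s⁻¹ sr<N) ¬last) ≤-refl fr<fsr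
                      (subst (f (suc r) <_) (sym fK) fsr<K))
    where
    fsr<K : f (suc r) < K
    fsr<K = below-top sr<N ¬top λ e → ¬last (injective sr<N ≤-refl (trans e (sym fK)))

  K-then-top⇒at-start : ∀ {q} → f q ≡ K → f (suc q) ≡ suc K → suc q < suc K → q ≡ 0
  K-then-top⇒at-start {zero}  _  _   _    = refl
  K-then-top⇒at-start {suc q} fq fsq sq<N =
    ⊥-elim (avoids123 z<s ≤-refl sq<N (subst (f 0 <_) (sym fq) f0<K) (subst₂ _<_ (sym fq) (sym fsq) ≤-refl))
    where
    f0<K : f 0 < K
    f0<K = below-top z<s (λ e → contradiction (injective z<s sq<N (trans e (sym fsq))) λ ())
                         (λ e → contradiction (injective z<s (<-trans (n<1+n (suc q)) sq<N) (trans e (sym fq))) λ ())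

  top-pair-first : Odd K → 7 ≤ K → f 0 ≡ K × f 1 ≡ suc K
  top-pair-first oddK 7≤K with surjective (≤-trans z<s 7≤K) (n≤1+n K)
  ... | q , q<N , fq with proj₂ (isDumont q<N) (subst Odd (sym fq) oddK)
  ... | inj₂ (sq<N , K<fsq) =
        subst (λ q → f q ≡ K × f (suc q) ≡ suc K) (K-then-top⇒at-start fq fsq sq<N) (fq , fsq)
    where
    fsq : f (suc q) ≡ suc K
    fsq = ≤-antisym (proj₂ (bounded sq<N)) (subst (_< f (suc q)) fq K<fsq)
  ... | inj₁ last = ⊥-elim (no-three-in-two (precedes (even-ss even-zero) (from-yes (1 <? 7)))
                                            (precedes (even-ss (even-ss even-zero)) (from-yes (3 <? 7)))
                                            (precedes (even-ss (even-ss (even-ss even-zero))) (from-yes (5 <? 7))))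
    where
    fK : f K ≡ K
    fK = subst (λ i → f i ≡ K) (suc-injective last) fq
    top : ∃ λ p → p < suc K × f p ≡ suc K
    top = surjective z<s ≤-refl
    precedes : ∀ {v} → Odd v → v < 7 → v ≡ f (pred (proj₁ top)) ⊎ v ≡ f (pred K)
    precedes {suc _} odd v<7 =
      odd-precedes-top-or-last fK (proj₁ (proj₂ top)) (proj₂ (proj₂ top)) odd z<s (<-≤-trans v<7 7≤K)

-- Lengths are written (3 + m) * 2 rather than 2 * (3 + m) because (suc m) * 2 unfolds to 2 + m * 2.
word : ℕ → Fin 4 → Word
word zero    β = block β
word (suc m) β = prependTop ((3 + m) * 2) (word m β)

word-isD¹123Word : ∀ m β → IsD¹123Word ((3 + m) * 2) (word m β)
word-isD¹123Word zero    β = block-isD¹123Word β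
word-isD¹123Word (suc m) β = prependTop-isD¹123Word (even-*2 (3 + m)) z<s (word-isD¹123Word m β)

word-injective : ∀ m {β β′} → word m β ≗⟨ (3 + m) * 2 ⟩ word m β′ → β ≡ β′
word-injective zero    e = block-injective e
word-injective (suc m) e = word-injective m (e ∘ s≤s ∘ s≤s)

classify : ∀ m {f} → IsD¹123Word ((3 + m) * 2) f → ∃ λ β → f ≗⟨ (3 + m) * 2 ⟩ word m β
classify zero    w = classify₆ w
classify (suc m) {f} w =
  let f0 , f1  = top-pair-first w (even-*2 (4 + m)) (m≤m+n 7 (m * 2))
      β , rest = classify m (dropTop-isD¹123Word w f0 f1)
  in  β , ≗-prependTop {f = f} f0 f1 rest

-- Permutations as words

record Spells {N} (π : Permutation′ N) (f : Word) : Set where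
  constructor spelling
  field val≡ : ∀ j → val π j ≡ f (toℕ j)

wordOf : ∀ {N} → Permutation′ N → Word
wordOf {N} π i with i <? N
... | yes i<N = val π (fromℕ< i<N)
... | no  _   = 0

wordOf-spells : ∀ {N} (π : Permutation′ N) → Spells π (wordOf π)
wordOf-spells {N} π = spelling val≡
  where
  val≡ : ∀ j → val π j ≡ wordOf π (toℕ j)
  val≡ j with toℕ j <? N
  ... | yes j<N = cong (val π) (sym (Fin.fromℕ<-toℕ j j<N))
  ... | no  j≮N = contradiction (Fin.toℕ<n j) j≮N

module _ {N} {π : Permutation′ N} {f} (spells : Spells π f) where
  open Spells spells

  spells-at : ∀ {i} (i<N : i < N) → f i ≡ val π (fromℕ< i<N)
  spells-at i<N = trans (cong f (sym (Fin.toℕ-fromℕ< i<N))) (sym (val≡ _))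

  spells-isPermWord : IsPermWord N f
  spells-isPermWord = record { bounded = bounded ; injective = injective ; surjective = surjective }
    where
    bounded : ∀ {i} → i < N → 0 < f i × f i ≤ N
    bounded i<N = subst (λ v → 0 < v × v ≤ N) (sym (spells-at i<N)) (z<s , Fin.toℕ<n _)
    injective : ∀ {i j} → i < N → j < N → f i ≡ f j → i ≡ j
    injective {i} {j} i<N j<N e = begin
      i                       ≡⟨ Fin.toℕ-fromℕ< i<N ⟨
      toℕ (fromℕ< i<N)        ≡⟨ cong toℕ (Injection.injective (↔⇒↣ π) (Fin.toℕ-injective same-value)) ⟩
      toℕ (fromℕ< j<N)        ≡⟨ Fin.toℕ-fromℕ< j<N ⟩
      j                       ∎
      where
      same-value : toℕ (π ⟨$⟩ʳ fromℕ< i<N) ≡ toℕ (π ⟨$⟩ʳ fromℕ< j<N)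
      same-value = suc-injective (trans (sym (spells-at i<N)) (trans e (spells-at j<N)))
    surjective : ∀ {v} → 0 < v → v ≤ N → ∃ λ i → i < N × f i ≡ v
    surjective {suc v} _ v<N = toℕ j , Fin.toℕ<n j , (begin
      f (toℕ j)                   ≡⟨ val≡ j ⟨
      suc (toℕ (π ⟨$⟩ʳ j))        ≡⟨ cong (suc ∘ toℕ) (inverseʳ π) ⟩
      suc (toℕ (fromℕ< v<N))      ≡⟨ cong suc (Fin.toℕ-fromℕ< v<N) ⟩
      suc v                       ∎)
      where j = π ⟨$⟩ˡ fromℕ< v<N

  avoids123⇒avoids123Word : Avoids123 π → Avoids123Word N f
  avoids123⇒avoids123Word av {i} {j} {l} i<j j<l l<N a b =
    av (fromℕ< i<N , fromℕ< j<N , fromℕ< l<N ,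
        subst₂ _<_ (sym (Fin.toℕ-fromℕ< i<N)) (sym (Fin.toℕ-fromℕ< j<N)) i<j ,
        subst₂ _<_ (sym (Fin.toℕ-fromℕ< j<N)) (sym (Fin.toℕ-fromℕ< l<N)) j<l ,
        subst₂ _<_ (spells-at i<N) (spells-at j<N) a ,
        subst₂ _<_ (spells-at j<N) (spells-at l<N) b)
    where
    j<N : j < N
    j<N = <-trans j<l l<N
    i<N : i < N
    i<N = <-trans i<j j<N

  avoids123Word⇒avoids123 : Avoids123Word N f → Avoids123 π
  avoids123Word⇒avoids123 av (i₁ , i₂ , i₃ , i₁<i₂ , i₂<i₃ , a , b) =
    av i₁<i₂ i₂<i₃ (Fin.toℕ<n i₃) (subst₂ _<_ (val≡ i₁) (val≡ i₂) a) (subst₂ _<_ (val≡ i₂) (val≡ i₃) b)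

module _ {N f} (p : IsPermWord N f) where
  open IsPermWord p

  private
    letter : ∀ {i} → i < N → ∃ λ (y : Fin N) → suc (toℕ y) ≡ f i
    letter {i} i<N with f i | bounded i<N
    ... | suc v | _ , v<N = fromℕ< v<N , cong suc (Fin.toℕ-fromℕ< v<N)

    position : Fin N → ℕ
    position y = proj₁ (surjective z<s (Fin.toℕ<n y))

    position<N : ∀ y → position y < N
    position<N y = proj₁ (proj₂ (surjective z<s (Fin.toℕ<n y)))

    f-position : ∀ y → f (position y) ≡ suc (toℕ y)
    f-position y = proj₂ (proj₂ (surjective z<s (Fin.toℕ<n y)))

    to from : Fin N → Fin N
    to   x = proj₁ (letter (Fin.toℕ<n x))
    from y = fromℕ< (position<N y)

    suc-to : ∀ x → suc (toℕ (to x)) ≡ f (toℕ x)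
    suc-to x = proj₂ (letter (Fin.toℕ<n x))

    to∘from : ∀ y → to (from y) ≡ y
    to∘from y = Fin.toℕ-injective (suc-injective (begin
      suc (toℕ (to (from y)))   ≡⟨ suc-to (from y) ⟩
      f (toℕ (from y))          ≡⟨ cong f (Fin.toℕ-fromℕ< (position<N y)) ⟩
      f (position y)            ≡⟨ f-position y ⟩
      suc (toℕ y)               ∎))

    from∘to : ∀ x → from (to x) ≡ x
    from∘to x = Fin.toℕ-injective (trans (Fin.toℕ-fromℕ< (position<N (to x)))
      (injective (position<N (to x)) (Fin.toℕ<n x) (trans (f-position (to x)) (suc-to x))))

  fromWord : Permutation′ N
  fromWord = permutation to from to∘from from∘to

  fromWord-spells : Spells fromWord f
  fromWord-spells = spelling suc-to

module _ {k} {π : Permutation′ (suc k)} {f} (spells : Spells π f) where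
  open Spells spells

  private
    next⁻ : ∀ {j} (R : ℕ → ℕ → Set) → (∃ λ (j′ : Fin k) → inject₁ j′ ≡ j × R (val π j) (val π (Fin.suc j′))) →
            suc (toℕ j) < suc k × R (f (toℕ j)) (f (suc (toℕ j)))
    next⁻ R (j′ , refl , r) =
      s≤s (subst (_< k) (sym (Fin.toℕ-inject₁ j′)) (Fin.toℕ<n j′)) ,
      subst₂ R (val≡ (inject₁ j′)) (trans (val≡ (Fin.suc j′)) (cong (f ∘ suc) (sym (Fin.toℕ-inject₁ j′)))) r

    next⁺ : ∀ {j} (R : ℕ → ℕ → Set) → suc (toℕ j) < suc k → R (f (toℕ j)) (f (suc (toℕ j))) →
            ∃ λ (j′ : Fin k) → inject₁ j′ ≡ j × R (val π j) (val π (Fin.suc j′))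
    next⁺ {j} R sj<N r = j′ , Fin.toℕ-injective (trans (Fin.toℕ-inject₁ j′) j′≡j) ,
      subst₂ R (sym (val≡ j)) (sym (trans (val≡ (Fin.suc j′)) (cong (f ∘ suc) j′≡j))) r
      where
      j′ = fromℕ< (s≤s⁻¹ sj<N)
      j′≡j : toℕ j′ ≡ toℕ j
      j′≡j = Fin.toℕ-fromℕ< (s≤s⁻¹ sj<N)

  isDumont1⇒isDumontWord : IsDumont1 π → IsDumontWord (suc k) f
  isDumont1⇒isDumontWord d i<N = subst (DumontAt (suc k) f) (Fin.toℕ-fromℕ< i<N) (descent , ascent)
    where
    j = fromℕ< i<N
    descent : Even (f (toℕ j)) → Descent (suc k) f (toℕ j)
    descent ev = next⁻ _>_ (proj₁ (d j) (subst Even (sym (val≡ j)) ev))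
    ascent : Odd (f (toℕ j)) → suc (toℕ j) ≡ suc k ⊎ Ascent (suc k) f (toℕ j)
    ascent od = Sum.map (cong suc) (next⁻ _<_) (proj₂ (d j) (subst Odd (sym (val≡ j)) od))

  isDumontWord⇒isDumont1 : IsDumontWord (suc k) f → IsDumont1 π
  isDumontWord⇒isDumont1 d j = descent , ascent
    where
    descent : Even (val π j) → ∃ λ (j′ : Fin k) → inject₁ j′ ≡ j × val π (Fin.suc j′) < val π j
    descent ev = let sj<N , lt = proj₁ (d (Fin.toℕ<n j)) (subst Even (val≡ j) ev) in next⁺ _>_ sj<N lt
    ascent : Odd (val π j) → toℕ j ≡ k ⊎ ∃ λ (j′ : Fin k) → inject₁ j′ ≡ j × val π j < val π (Fin.suc j′)
    ascent od = Sum.map suc-injective (λ (sj<N , lt) → next⁺ _<_ sj<N lt)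
                        (proj₂ (d (Fin.toℕ<n j)) (subst Odd (val≡ j) od))

  D1-123⇒isD¹123Word : D1-123 π → IsD¹123Word (suc k) f
  D1-123⇒isD¹123Word (d , a) = record
    { isPermWord = spells-isPermWord spells
    ; isDumont   = isDumont1⇒isDumontWord d
    ; avoids123  = avoids123⇒avoids123Word spells a
    }

  isD¹123Word⇒D1-123 : IsD¹123Word (suc k) f → D1-123 π
  isD¹123Word⇒D1-123 w = isDumontWord⇒isDumont1 isDumont , avoids123Word⇒avoids123 spells avoids123
    where open IsD¹123Word w

≗ₚ⇒≗ : ∀ {N} {π σ : Permutation′ N} {f g} → Spells π f → Spells σ g → π ≗ₚ σ → f ≗⟨ N ⟩ g
≗ₚ⇒≗ {π = π} {σ} {f} {g} sπ sσ e i<N = begin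
  f _                       ≡⟨ spells-at sπ i<N ⟩
  val π (fromℕ< i<N)        ≡⟨ cong (suc ∘ toℕ) (e _) ⟩
  val σ (fromℕ< i<N)        ≡⟨ spells-at sσ i<N ⟨
  g _                       ∎

≗⇒≗ₚ : ∀ {N} {π σ : Permutation′ N} {f g} → Spells π f → Spells σ g → f ≗⟨ N ⟩ g → π ≗ₚ σ
≗⇒≗ₚ sπ sσ e j = Fin.toℕ-injective (suc-injective
  (trans (Spells.val≡ sπ j) (trans (e (Fin.toℕ<n j)) (sym (Spells.val≡ sσ j)))))

hasCardinality-tabulate : ∀ {N k} {P : Permutation′ N → Set} (σ : Fin k → Permutation′ N) →
                          (∀ {β β′} → σ β ≗ₚ σ β′ → β ≡ β′) → (∀ β → P (σ β)) →
                          (∀ π → P π → ∃ λ β → π ≗ₚ σ β) → HasCardinality N P k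
hasCardinality-tabulate σ σ-injective σ-P complete =
  tabulate σ , length-tabulate σ , AllPairs.tabulate⁺ (λ β≢β′ → β≢β′ ∘ σ-injective) , All.tabulate⁺ σ-P ,
  λ π Pπ → let β , π≗σβ = complete π Pπ in Any.tabulate⁺ β π≗σβ

D¹-123-hasCardinality : ∀ m → HasCardinality ((3 + m) * 2) D1-123 4
D¹-123-hasCardinality m = hasCardinality-tabulate σ σ-injective σ-D1-123 complete
  where
  σ : Fin 4 → Permutation′ ((3 + m) * 2)
  σ β = fromWord (IsD¹123Word.isPermWord (word-isD¹123Word m β))
  σ-spells : ∀ β → Spells (σ β) (word m β)
  σ-spells β = fromWord-spells (IsD¹123Word.isPermWord (word-isD¹123Word m β))
  σ-injective : ∀ {β β′} → σ β ≗ₚ σ β′ → β ≡ β′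
  σ-injective e = word-injective m (≗ₚ⇒≗ (σ-spells _) (σ-spells _) e)
  σ-D1-123 : ∀ β → D1-123 (σ β)
  σ-D1-123 β = isD¹123Word⇒D1-123 (σ-spells β) (word-isD¹123Word m β)
  complete : ∀ π → D1-123 π → ∃ λ β → π ≗ₚ σ β
  complete π d =
    let β , π≗word = classify m (D1-123⇒isD¹123Word π-spells d)
    in β , ≗⇒≗ₚ π-spells (σ-spells β) π≗word
    where π-spells = wordOf-spells π

theorem2p6 : (n : ℕ) → 3 ≤ n → HasCardinality (2 * n) D1-123 4
theorem2p6 (suc (suc (suc m))) (s≤s (s≤s (s≤s z≤n))) =
  subst (λ N → HasCardinality N D1-123 4) (*-comm (3 + m) 2) (D¹-123-hasCardinality m)
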